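{- For every $t\in\mathbb{N}$ and every $\epsilon>0$ there is a $d\in\mathbb{N}$ such that every connected, induced $S_{t,t}$-free bipartite graph $G$ with minimum degree $\delta(G)\geq d$ whose two parts each have $n$ vertices satisfies $e(G)\geq (1-\epsilon)n^2$.
   Context: For $a,b\in\mathbb{N}$, the $(a,b)$-biclaw $S_{a,b}$ is the graph with vertex set $\{x,x_1,\dots,x_a,y,y_1,\dots,y_b\}$ and edge set $\{xy\}\cup\{xy_1,\dots,xy_b\}\cup\{yx_1,\dots,yx_a\}$. A graph is induced $H$-free if it contains no induced subgraph isomorphic to $H$. $e(G)$ denotes the number of edges of $G$.
   Formalization: The parameter ε ranges over the positive rationals. -}

module Defs where

open import Data.Nat using (ℕ; zero; suc; _+_; _*_; _≤_)
open import Data.Bool using (Bool; true; false; if_then_else_)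
open import Data.Fin using (Fin; zero; suc)
open import Data.Sum using (_⊎_; inj₁; inj₂)
open import Data.Product using (_×_; _,_)
open import Data.Empty using (⊥)
open import Data.Unit using (⊤)
open import Data.Integer using (+_)
open import Data.Rational using (ℚ; _/_)
open import Function.Definitions using (Injective)
open import Relation.Binary.PropositionalEquality using (_≡_)
open import Relation.Binary.Construct.Closure.ReflexiveTransitive using (Star)

record Graph (V : Set) : Set₁ where
  field
    Adj    : V → V → Set
    sym    : ∀ {u v} → Adj u v → Adj v u
    irrefl : ∀ {v} → Adj v v → ⊥
open Graph public

-- The (a,b)-biclaw S_{a,b}: vertices x, x_1..x_a, y, y_1..y_b;
-- edges xy, x y_j (j ≤ b), y x_i (i ≤ a).
data SV (a b : ℕ) : Set where
  vx : SV a b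
  vy : SV a b
  vxi : Fin a → SV a b
  vyj : Fin b → SV a b

SAdj : ∀ {a b} → SV a b → SV a b → Set
SAdj vx vy = ⊤
SAdj vy vx = ⊤
SAdj vx (vyj _) = ⊤
SAdj (vyj _) vx = ⊤
SAdj vy (vxi _) = ⊤
SAdj (vxi _) vy = ⊤
SAdj _ _ = ⊥

record InducedBiclaw {V : Set} (G : Graph V) (a b : ℕ) : Set where
  field
    f     : SV a b → V
    inj   : Injective _≡_ _≡_ f
    pres  : ∀ u v → SAdj u v → Adj G (f u) (f v)
    refl' : ∀ u v → Adj G (f u) (f v) → SAdj u v

InducedBiclawFree : ∀ {V : Set} → Graph V → ℕ → ℕ → Set
InducedBiclawFree G a b = InducedBiclaw G a b → ⊥

Connected : ∀ {V : Set} → Graph V → Set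
Connected {V} G = ∀ (u v : V) → Star (Adj G) u v

-- Bipartite graph with parts L = Fin n and R = Fin n given by its
-- biadjacency matrix B (B i j = true iff left vertex i ~ right vertex j).
BAdj : ∀ {n} → (Fin n → Fin n → Bool) → Fin n ⊎ Fin n → Fin n ⊎ Fin n → Set
BAdj B (inj₁ i) (inj₂ j) = B i j ≡ true
BAdj B (inj₂ j) (inj₁ i) = B i j ≡ true
BAdj B _ _ = ⊥

bipGraph : ∀ {n} → (Fin n → Fin n → Bool) → Graph (Fin n ⊎ Fin n)
bipGraph B = record { Adj = BAdj B ; sym = s ; irrefl = ir }
  where
    s : ∀ {u v} → BAdj B u v → BAdj B v u
    s {inj₁ i} {inj₂ j} p = p
    s {inj₂ j} {inj₁ i} p = p
    ir : ∀ {v} → BAdj B v v → ⊥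
    ir {inj₁ _} ()
    ir {inj₂ _} ()

count : ∀ {m} → (Fin m → Bool) → ℕ
count {zero} P = 0
count {suc m} P = (if P zero then 1 else 0) + count (λ k → P (suc k))

deg : ∀ {n} → (Fin n → Fin n → Bool) → Fin n ⊎ Fin n → ℕ
deg B (inj₁ i) = count (λ j → B i j)
deg B (inj₂ j) = count (λ i → B i j)

MinDegAtLeast : ∀ {n} → (Fin n → Fin n → Bool) → ℕ → Set
MinDegAtLeast {n} B d = ∀ (v : Fin n ⊎ Fin n) → d ≤ deg B v

sumF : ∀ {m} → (Fin m → ℕ) → ℕ
sumF {zero} g = 0
sumF {suc m} g = g zero + sumF (λ k → g (suc k))

edges : ∀ {n} → (Fin n → Fin n → Bool) → ℕ
edges B = sumF (λ i → count (λ j → B i j))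

ℕtoℚ : ℕ → ℚ
ℕtoℚ k = (+ k) / 1

module Submission where

-- Fix q and call a left vertex z far from x if N(z) misses at least |N(x)|/q vertices of N(x).
-- Induced S_{t,t}-freeness bounds, for every edge xy, the number of neighbours of y far from x by
-- K = t(2q)^t: from more of them one greedily extracts t far neighbours of y and t neighbours of x
-- with no edges in between. Let x₀ have maximum degree D. A right vertex with a neighbour near x₀
-- has fewer than 3K neighbours far from x₀, and this property spreads along edges, so by
-- connectivity it holds everywhere; double counting then shows that at most n/q vertices are far
-- from x₀ once δ ≥ q(3K+1). A vertex near x₀ misses at most the non-neighbours of x₀ and D/q ≤ n/q
-- further vertices, and the same argument on the side whose maximum degree is at least D bounds
-- the non-neighbours of x₀ by 3n/q. Hence there are at most 5n²/q non-edges, and q = 5·den(ε)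
-- gives the theorem since ε ≥ 1/den(ε).

module BiclawFreeDensity where

  open import Defs hiding (sym)
  open import Data.Nat using (ℕ; zero; suc; _+_; _*_; _^_; _≤_; _<_; _≤?_; z≤n; s≤s; NonZero; >-nonZero)
  open import Data.Nat.Properties hiding (_≟_; suc-injective)
  open import Algebra.Properties.CommutativeSemigroup +-commutativeSemigroup using (interchange)
  open import Data.Bool using (Bool; true; false; _∧_; _∨_; not; if_then_else_)
  open import Data.Bool.Properties
    using (∨-identityʳ; ∨-zeroʳ; ∧-inverseʳ; ∧-zeroʳ; ∧-comm) renaming (_≟_ to _≟ᵇ_)
  open import Data.Fin using (Fin; zero; suc)
  open import Data.Fin.Properties using (suc-injective; _≟_; any?)
  open import Data.Product using (Σ; ∃; _×_; _,_; proj₁; proj₂)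
  open import Data.Sum using (_⊎_; inj₁; inj₂; swap)
  open import Data.Sum.Properties using (inj₁-injective; inj₂-injective; swap-involutive)
  open import Data.Unit using (tt)
  open import Data.Empty using (⊥)
  open import Function using (_∘_; id; flip; case_of_)
  open import Function.Definitions using (Injective)
  open import Relation.Binary.PropositionalEquality
  open import Data.Nat.Tactic.RingSolver using (solve-∀)
  open import Relation.Binary.Construct.Closure.ReflexiveTransitive using (Star; gmap; fold)
  open import Relation.Nullary using (¬_; Dec; yes; no; does; contradiction)
  open import Relation.Nullary.Decidable using (_×-dec_; dec-true; dec-false)

  -- Subsets of Fin m as Boolean functions: counting and double counting

  private variable
    m k : ℕ

  infixr 7 _∩_
  infixr 6 _∪_ _∖_
  infix 4 _⊆_

  _∩_ _∪_ _∖_ : (Fin m → Bool) → (Fin m → Bool) → Fin m → Bool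
  (P ∩ Q) i = P i ∧ Q i
  (P ∪ Q) i = P i ∨ Q i
  (P ∖ Q) i = P i ∧ not (Q i)

  _⊆_ : (Fin m → Bool) → (Fin m → Bool) → Set
  P ⊆ Q = ∀ {i} → P i ≡ true → Q i ≡ true

  ⁅_⁆ : Fin m → Fin m → Bool
  ⁅ b ⁆ i = does (i ≟ b)

  ∧-true⁻ : ∀ {a b} → a ∧ b ≡ true → a ≡ true × b ≡ true
  ∧-true⁻ {true} b≡true = refl , b≡true

  ∧-false⁻ʳ : ∀ {a b} → a ≡ true → a ∧ b ≡ false → b ≡ false
  ∧-false⁻ʳ refl b≡false = b≡false

  not-true⁻ : ∀ {a} → not a ≡ true → a ≡ false
  not-true⁻ {false} _ = refl

  ∖-true⁻ : ∀ {a b} → a ∧ not b ≡ true → a ≡ true × b ≡ false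
  ∖-true⁻ {true} {false} _ = refl , refl

  ind : Bool → ℕ
  ind b = if b then 1 else 0

  ind-mono : ∀ {a b} → (a ≡ true → b ≡ true) → ind a ≤ ind b
  ind-mono {false} _ = z≤n
  ind-mono {true} a⇒b rewrite a⇒b refl = ≤-refl

  ind-∨ : ∀ a b → ind (a ∨ b) ≤ ind a + ind b
  ind-∨ false b = ≤-refl
  ind-∨ true  b = m≤m+n 1 (ind b)

  ind-split : ∀ a b → ind a ≡ ind (a ∧ b) + ind (a ∧ not b)
  ind-split false b     = refl
  ind-split true  false = refl
  ind-split true  true  = refl

  count-cong : {P Q : Fin m → Bool} → (∀ i → P i ≡ Q i) → count P ≡ count Q
  count-cong {zero}  _   = refl
  count-cong {suc m} P≗Q = cong₂ _+_ (cong ind (P≗Q zero)) (count-cong (λ i → P≗Q (suc i)))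

  count-mono : {P Q : Fin m → Bool} → P ⊆ Q → count P ≤ count Q
  count-mono {zero}  _   = z≤n
  count-mono {suc m} {P} {Q} P⊆Q =
    +-mono-≤ (ind-mono P⊆Q) (count-mono {P = P ∘ suc} {Q ∘ suc} P⊆Q)

  count-∪ : (P Q : Fin m → Bool) → count (P ∪ Q) ≤ count P + count Q
  count-∪ {zero}  P Q = z≤n
  count-∪ {suc m} P Q = begin
    ind (P zero ∨ Q zero) + count ((P ∪ Q) ∘ suc)
      ≤⟨ +-mono-≤ (ind-∨ (P zero) (Q zero)) (count-∪ (P ∘ suc) (Q ∘ suc)) ⟩
    (ind (P zero) + ind (Q zero)) + (count (P ∘ suc) + count (Q ∘ suc))
      ≡⟨ interchange (ind (P zero)) _ _ _ ⟩
    count P + count Q ∎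
    where open ≤-Reasoning

  count-⊆-∪ : {P Q R : Fin m → Bool} → P ⊆ Q ∪ R → count P ≤ count Q + count R
  count-⊆-∪ {P = P} {Q} {R} P⊆Q∪R = ≤-trans (count-mono {P = P} {Q ∪ R} P⊆Q∪R) (count-∪ Q R)

  count-split : (P Q : Fin m → Bool) → count P ≡ count (P ∩ Q) + count (P ∖ Q)
  count-split {zero}  P Q = refl
  count-split {suc m} P Q = begin
    ind (P zero) + count (P ∘ suc)
      ≡⟨ cong₂ _+_ (ind-split (P zero) (Q zero)) (count-split (P ∘ suc) (Q ∘ suc)) ⟩
    (ind ((P ∩ Q) zero) + ind ((P ∖ Q) zero)) + (count ((P ∩ Q) ∘ suc) + count ((P ∖ Q) ∘ suc))
      ≡⟨ interchange (ind ((P ∩ Q) zero)) _ _ _ ⟩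
    count (P ∩ Q) + count (P ∖ Q) ∎
    where open ≡-Reasoning

  count≤size : (P : Fin m → Bool) → count P ≤ m
  count≤size {zero}  P = z≤n
  count≤size {suc m} P = +-mono-≤ (ind-mono {b = true} λ _ → refl) (count≤size (P ∘ suc))

  count-pos : (P : Fin m → Bool) {i : Fin m} → P i ≡ true → 0 < count P
  count-pos P {zero}  P0 rewrite P0 = s≤s z≤n
  count-pos P {suc i} Pi = ≤-trans (count-pos (P ∘ suc) Pi) (m≤n+m _ (ind (P zero)))

  count-∅ : {P : Fin m → Bool} → (∀ i → P i ≡ false) → count P ≡ 0
  count-∅ {zero}  _ = refl
  count-∅ {suc m} P≡false rewrite P≡false zero = count-∅ (λ i → P≡false (suc i))

  count-full : ∀ m → count {m} (λ _ → true) ≡ m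
  count-full zero    = refl
  count-full (suc m) = cong suc (count-full m)

  count-pos⇒∃ : (P : Fin m → Bool) → 0 < count P → ∃ λ i → P i ≡ true
  count-pos⇒∃ {suc m} P pos with P zero in P0
  ... | true  = zero , P0
  ... | false = let i , Pi = count-pos⇒∃ (P ∘ suc) pos in suc i , Pi

  count-<⇒∃∖ : (P Q : Fin m → Bool) → count Q < count P → ∃ λ i → P i ≡ true × Q i ≡ false
  count-<⇒∃∖ P Q Q<P with count-pos⇒∃ (P ∖ Q) (+-cancelˡ-< (count Q) 0 _ (begin-strict
      count Q + 0                 ≡⟨ +-identityʳ (count Q) ⟩
      count Q                     <⟨ Q<P ⟩
      count P                     ≡⟨ count-split P Q ⟩
      count (P ∩ Q) + count (P ∖ Q) ≤⟨ +-monoˡ-≤ _ (count-mono {P = P ∩ Q} {Q} (proj₂ ∘ ∧-true⁻)) ⟩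
      count Q + count (P ∖ Q)     ∎))
    where open ≤-Reasoning
  ... | i , P∖Qi = i , ∖-true⁻ P∖Qi

  count-insert : (Q : Fin m → Bool) {b : Fin m} → Q b ≡ false → count (Q ∪ ⁅ b ⁆) ≡ suc (count Q)
  count-insert {suc m} Q {zero} Q0 rewrite Q0 =
    cong suc (count-cong λ i → ∨-identityʳ (Q (suc i)))
  count-insert {suc m} Q {suc b} Qb rewrite ∨-identityʳ (Q zero) =
    trans (cong (ind (Q zero) +_) (count-insert (Q ∘ suc) Qb)) (+-suc (ind (Q zero)) _)

  count-enumerate : (P : Fin m → Bool) → k ≤ count P →
    Σ (Fin k → Fin m) λ g → Injective _≡_ _≡_ g × (∀ i → P (g i) ≡ true)
  count-enumerate {k = zero} P _ = (λ ()) , (λ { {()} }) , λ ()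
  count-enumerate {suc m} {suc k} P k<P with P zero in P0
  ... | false = let g , g-inj , Pg = count-enumerate (P ∘ suc) k<P
                in suc ∘ g , g-inj ∘ suc-injective , Pg
  ... | true  = let g , g-inj , Pg = count-enumerate (P ∘ suc) (≤-pred k<P)
                in cons g , cons-inj g-inj , Pcons Pg
    where
    cons : (Fin k → Fin m) → Fin (suc k) → Fin (suc m)
    cons g zero    = zero
    cons g (suc i) = suc (g i)
    cons-inj : {g : Fin k → Fin m} → Injective _≡_ _≡_ g → Injective _≡_ _≡_ (cons g)
    cons-inj g-inj {zero}  {zero}  _  = refl
    cons-inj g-inj {suc i} {suc j} eq = cong suc (g-inj (suc-injective eq))
    Pcons : {g : Fin k → Fin m} → (∀ i → P (suc (g i)) ≡ true) → ∀ i → P (cons g i) ≡ true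
    Pcons Pg zero    = P0
    Pcons Pg (suc i) = Pg i

  sumF-cong : {f g : Fin m → ℕ} → (∀ i → f i ≡ g i) → sumF f ≡ sumF g
  sumF-cong {zero}  _   = refl
  sumF-cong {suc m} f≗g = cong₂ _+_ (f≗g zero) (sumF-cong (λ i → f≗g (suc i)))

  sumF-mono : {f g : Fin m → ℕ} → (∀ i → f i ≤ g i) → sumF f ≤ sumF g
  sumF-mono {zero}  _   = z≤n
  sumF-mono {suc m} f≤g = +-mono-≤ (f≤g zero) (sumF-mono (λ i → f≤g (suc i)))

  sumF-+ : (f g : Fin m → ℕ) → sumF (λ i → f i + g i) ≡ sumF f + sumF g
  sumF-+ {zero}  f g = refl
  sumF-+ {suc m} f g =
    trans (cong (f zero + g zero +_) (sumF-+ (f ∘ suc) (g ∘ suc))) (interchange (f zero) _ _ _)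

  sumF-const : ∀ m (c : ℕ) → sumF {m} (λ _ → c) ≡ m * c
  sumF-const zero    c = refl
  sumF-const (suc m) c = cong (c +_) (sumF-const m c)

  sumF-*ˡ : (c : ℕ) (f : Fin m → ℕ) → sumF (λ i → c * f i) ≡ c * sumF f
  sumF-*ˡ {zero}  c f = sym (*-zeroʳ c)
  sumF-*ˡ {suc m} c f =
    trans (cong (c * f zero +_) (sumF-*ˡ c (f ∘ suc))) (sym (*-distribˡ-+ c (f zero) _))

  sumF-ind-* : (P : Fin m → Bool) (c : ℕ) → sumF (λ i → ind (P i) * c) ≡ count P * c
  sumF-ind-* {zero}  P c = refl
  sumF-ind-* {suc m} P c = trans (cong (ind (P zero) * c +_) (sumF-ind-* (P ∘ suc) c))
    (sym (*-distribʳ-+ c (ind (P zero)) (count (P ∘ suc))))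

  count≡sumF-ind : (P : Fin m → Bool) → count P ≡ sumF (ind ∘ P)
  count≡sumF-ind P = trans (sym (*-identityʳ (count P)))
    (trans (sym (sumF-ind-* P 1)) (sumF-cong (λ i → *-identityʳ (ind (P i)))))

  sumF-swap : (f : Fin m → Fin k → ℕ) → sumF (λ i → sumF (f i)) ≡ sumF (λ j → sumF (λ i → f i j))
  sumF-swap {zero} {k} f = sym (trans (sumF-const k 0) (*-zeroʳ k))
  sumF-swap {suc m}    f = trans (cong (sumF (f zero) +_) (sumF-swap (f ∘ suc)))
    (sym (sumF-+ (f zero) (λ j → sumF (λ i → f (suc i) j))))

  count-swap : (R : Fin m → Fin k → Bool) → sumF (λ i → count (R i)) ≡ sumF (λ j → count (λ i → R i j))
  count-swap R = begin
    sumF (λ i → count (R i))                    ≡⟨ sumF-cong (λ i → count≡sumF-ind (R i)) ⟩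
    sumF (λ i → sumF (λ j → ind (R i j)))       ≡⟨ sumF-swap (λ i j → ind (R i j)) ⟩
    sumF (λ j → sumF (λ i → ind (R i j)))       ≡⟨ sumF-cong (λ j → sym (count≡sumF-ind (λ i → R i j))) ⟩
    sumF (λ j → count (λ i → R i j))            ∎
    where open ≡-Reasoning

  count*≤sumF : (P : Fin m → Bool) {a : ℕ} {f : Fin m → ℕ} →
    (∀ {i} → P i ≡ true → a ≤ f i) → count P * a ≤ sumF f
  count*≤sumF P {a} {f} a≤f = subst (_≤ sumF f) (sumF-ind-* P a) (sumF-mono pointwise)
    where
    pointwise : ∀ i → ind (P i) * a ≤ f i
    pointwise i with P i in Pi
    ... | true  = subst (_≤ f i) (sym (+-identityʳ a)) (a≤f Pi)
    ... | false = z≤n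

  sumF≤count*+ : (P : Fin m → Bool) {a b : ℕ} {f : Fin m → ℕ} →
    (∀ {i} → P i ≡ true → f i ≤ a + b) → (∀ {i} → P i ≡ false → f i ≤ b) →
    sumF f ≤ count P * a + m * b
  sumF≤count*+ {m} P {a} {b} {f} on-P off-P = begin
    sumF f                                ≤⟨ sumF-mono pointwise ⟩
    sumF (λ i → ind (P i) * a + b)        ≡⟨ sumF-+ (λ i → ind (P i) * a) (λ _ → b) ⟩
    sumF (λ i → ind (P i) * a) + sumF {m} (λ _ → b) ≡⟨ cong₂ _+_ (sumF-ind-* P a) (sumF-const m b) ⟩
    count P * a + m * b                   ∎
    where
    open ≤-Reasoning
    pointwise : ∀ i → f i ≤ ind (P i) * a + b
    pointwise i with P i in Pi
    ... | true  = subst (λ c → f i ≤ c + b) (sym (+-identityʳ a)) (on-P Pi)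
    ... | false = off-P Pi

  averaging : (P : Fin m → Bool) {a : ℕ} {f : Fin m → ℕ} → 0 < count P →
    (∀ {i} → P i ≡ false → f i ≡ 0) → count P * a ≤ sumF f → ∃ λ i → P i ≡ true × a ≤ f i
  averaging P {a} {f} P≢∅ off-P Pa≤Σf with any? (λ i → (P i ≟ᵇ true) ×-dec (a ≤? f i))
  ... | yes (i , Pi , a≤fi) = i , Pi , a≤fi
  ... | no  ∄i = contradiction (+-cancelˡ-≤ (count P * a) _ _ (begin
    count P * a + count P        ≤⟨ +-monoˡ-≤ _ Pa≤Σf ⟩
    sumF f + count P             ≡⟨ cong (sumF f +_) (count≡sumF-ind P) ⟩
    sumF f + sumF (ind ∘ P)      ≡⟨ sumF-+ f (ind ∘ P) ⟨
    sumF (λ i → f i + ind (P i)) ≤⟨ sumF-mono pointwise ⟩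
    sumF (λ i → ind (P i) * a)   ≡⟨ sumF-ind-* P a ⟩
    count P * a                  ≡⟨ +-identityʳ _ ⟨
    count P * a + 0              ∎)) (<⇒≱ P≢∅)
    where
    open ≤-Reasoning
    pointwise : ∀ i → f i + ind (P i) ≤ ind (P i) * a
    pointwise i with P i in Pi
    ... | true  = subst₂ _≤_ (+-comm 1 (f i)) (sym (+-identityʳ a)) (≰⇒> λ a≤fi → ∄i (i , Pi , a≤fi))
    ... | false = ≤-reflexive (cong (_+ 0) (off-P Pi))

  -- Far vertices and induced biclaws

  does-true⁻ : ∀ {A : Set} (a? : Dec A) → does a? ≡ true → A
  does-true⁻ (yes a) _ = a

  does-false⁻ : ∀ {A : Set} (a? : Dec A) → does a? ≡ false → ¬ A
  does-false⁻ (no ¬a) _ = ¬a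

  module _ {n : ℕ} (B : Fin n → Fin n → Bool) where

    missing : Fin n → Fin n → ℕ
    missing x z = count (B x ∖ B z)

    Far : ℕ → Fin n → Fin n → Bool
    Far q x z = does (count (B x) ≤? q * missing x z)

    far⁻ : ∀ q {x z} → Far q x z ≡ true → count (B x) ≤ q * missing x z
    far⁻ q {x} {z} = does-true⁻ (count (B x) ≤? q * missing x z)

    near⁻ : ∀ q {x z} → Far q x z ≡ false → q * missing x z < count (B x)
    near⁻ q {x} {z} = ≰⇒> ∘ does-false⁻ (count (B x) ≤? q * missing x z)

    missing-self : ∀ x → missing x x ≡ 0
    missing-self x = count-∅ λ b → ∧-inverseʳ (B x b)

    missing-triangle : ∀ x v z → missing x z ≤ missing x v + missing v z
    missing-triangle x v z = count-⊆-∪ {P = B x ∖ B z} {B x ∖ B v} {B v ∖ B z} (split (B x _) (B v _) (B z _))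
      where
      split : ∀ p q r → p ∧ not r ≡ true → (p ∧ not q) ∨ (q ∧ not r) ≡ true
      split true false r _  = refl
      split true true false _ = refl

    missing-≤-of-deg-≤ : ∀ {x z} → count (B z) ≤ count (B x) → missing z x ≤ missing x z
    missing-≤-of-deg-≤ {x} {z} degz≤degx = +-cancelˡ-≤ (count (B x ∩ B z)) _ _ (begin
      count (B x ∩ B z) + count (B z ∖ B x)
        ≡⟨ cong (_+ count (B z ∖ B x)) (count-cong λ j → ∧-comm (B x j) (B z j)) ⟩
      count (B z ∩ B x) + count (B z ∖ B x)   ≡⟨ count-split (B z) (B x) ⟨
      count (B z)                             ≤⟨ degz≤degx ⟩
      count (B x)                             ≡⟨ count-split (B x) (B z) ⟩
      count (B x ∩ B z) + count (B x ∖ B z)   ∎)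
      where open ≤-Reasoning

    not-far-from-self : ∀ {q x} → 0 < count (B x) → Far q x x ≡ false
    not-far-from-self {q} {x} deg>0 = dec-false (count (B x) ≤? q * missing x x) λ deg≤0 →
      <⇒≱ deg>0 (subst (count (B x) ≤_) (trans (cong (q *_) (missing-self x)) (*-zeroʳ q)) deg≤0)

    inducedBiclaw : ∀ {a b x y} → B x y ≡ true →
      (xs : Fin a → Fin n) → Injective _≡_ _≡_ xs → (∀ i → B (xs i) y ≡ true) → (∀ i → xs i ≢ x) →
      (ys : Fin b → Fin n) → Injective _≡_ _≡_ ys → (∀ j → B x (ys j) ≡ true) → (∀ j → ys j ≢ y) →
      (∀ i j → B (xs i) (ys j) ≡ false) → InducedBiclaw (bipGraph B) a b
    inducedBiclaw {a} {b} {x} {y} xy xs xs-inj xs-y xs≢x ys ys-inj x-ys ys≢y xs-ys =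
      record { f = f ; inj = f-inj ; pres = f-pres ; refl' = f-refl }
      where
      f : SV a b → Fin n ⊎ Fin n
      f vx      = inj₁ x
      f vy      = inj₂ y
      f (vxi i) = inj₁ (xs i)
      f (vyj j) = inj₂ (ys j)
      f-inj : Injective _≡_ _≡_ f
      f-inj {vx}    {vx}    _    = refl
      f-inj {vy}    {vy}    _    = refl
      f-inj {vx}    {vxi i} refl = contradiction refl (xs≢x i)
      f-inj {vxi i} {vx}    refl = contradiction refl (xs≢x i)
      f-inj {vy}    {vyj j} refl = contradiction refl (ys≢y j)
      f-inj {vyj j} {vy}    refl = contradiction refl (ys≢y j)
      f-inj {vxi i} {vxi _} eq   = cong vxi (xs-inj (inj₁-injective eq))
      f-inj {vyj j} {vyj _} eq   = cong vyj (ys-inj (inj₂-injective eq))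
      f-pres : ∀ u v → SAdj u v → Adj (bipGraph B) (f u) (f v)
      f-pres vx      vy      _ = xy
      f-pres vy      vx      _ = xy
      f-pres vx      (vyj j) _ = x-ys j
      f-pres (vyj j) vx      _ = x-ys j
      f-pres vy      (vxi i) _ = xs-y i
      f-pres (vxi i) vy      _ = xs-y i
      f-refl : ∀ u v → Adj (bipGraph B) (f u) (f v) → SAdj u v
      f-refl vx      vy      _ = tt
      f-refl vy      vx      _ = tt
      f-refl vx      (vyj j) _ = tt
      f-refl (vyj j) vx      _ = tt
      f-refl vy      (vxi i) _ = tt
      f-refl (vxi i) vy      _ = tt
      f-refl (vxi i) (vyj j) e = contradiction (trans (sym e) (xs-ys i j)) λ ()
      f-refl (vyj j) (vxi i) e = contradiction (trans (sym e) (xs-ys i j)) λ ()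

  swap-adj : ∀ {n} (B : Fin n → Fin n → Bool) {u v} → BAdj B u v → BAdj (flip B) (swap u) (swap v)
  swap-adj B {inj₁ _} {inj₂ _} e = e
  swap-adj B {inj₂ _} {inj₁ _} e = e

  swap-adj⁻ : ∀ {n} (B : Fin n → Fin n → Bool) {u v} → BAdj (flip B) (swap u) (swap v) → BAdj B u v
  swap-adj⁻ B {inj₁ _} {inj₂ _} e = e
  swap-adj⁻ B {inj₂ _} {inj₁ _} e = e

  module _ {n : ℕ} (B : Fin n → Fin n → Bool) where

    flip-biclawFree : ∀ {a b} → InducedBiclawFree (bipGraph B) a b → InducedBiclawFree (bipGraph (flip B)) a b
    flip-biclawFree free S = free record
      { f     = swap ∘ f
      ; inj   = inj ∘ swap-injective
      ; pres  = λ u v → swap-adj (flip B) ∘ pres u v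
      ; refl' = λ u v → refl' u v ∘ swap-adj⁻ (flip B)
      }
      where
      open InducedBiclaw S
      swap-injective : ∀ {u v : Fin n ⊎ Fin n} → swap u ≡ swap v → u ≡ v
      swap-injective {u} {v} eq = subst₂ _≡_ (swap-involutive u) (swap-involutive v) (cong swap eq)

    flip-connected : Connected (bipGraph B) → Connected (bipGraph (flip B))
    flip-connected conn u v = subst₂ (Star (BAdj (flip B))) (swap-involutive u) (swap-involutive v)
      (gmap swap (swap-adj B) (conn (swap u) (swap v)))

    flip-minDeg : ∀ {d} → MinDegAtLeast B d → MinDegAtLeast (flip B) d
    flip-minDeg δ≥d (inj₁ i) = δ≥d (inj₂ i)
    flip-minDeg δ≥d (inj₂ j) = δ≥d (inj₁ j)

  absorb-≤ : ∀ p {D m r s} → D ≤ p * m → m ≤ r + s → 2 * p * s ≤ D → D ≤ 2 * p * r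
  absorb-≤ p {D} {m} {r} {s} D≤pm m≤r+s 2ps≤D = +-cancelʳ-≤ D D (2 * p * r) (begin
    D + D                   ≡⟨ cong (D +_) (+-identityʳ D) ⟨
    2 * D                   ≤⟨ *-monoʳ-≤ 2 D≤pm ⟩
    2 * (p * m)             ≡⟨ *-assoc 2 p m ⟨
    2 * p * m               ≤⟨ *-monoʳ-≤ (2 * p) m≤r+s ⟩
    2 * p * (r + s)         ≡⟨ *-distribˡ-+ (2 * p) r s ⟩
    2 * p * r + 2 * p * s   ≤⟨ +-monoʳ-≤ (2 * p * r) 2ps≤D ⟩
    2 * p * r + D           ∎)
    where open ≤-Reasoning

  module _ {n : ℕ} (B : Fin n → Fin n → Bool) {t q : ℕ} .{{_ : NonZero q}}
           (free : InducedBiclawFree (bipGraph B) t t)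
           {x y : Fin n} (xy : B x y ≡ true) (2qt≤deg : 2 * q * t ≤ count (B x)) where

    private
      instance
        2q≢0 : NonZero (2 * q)
        2q≢0 = m*n≢0 2 q

      D = count (B x)

      FarNbr : Fin n → Bool
      FarNbr = flip B y ∩ Far B q x

      Anticomplete : (Fin n → Bool) → (Fin n → Bool) → Set
      Anticomplete A Q = ∀ {a b} → A a ≡ true → Q b ≡ true → B a b ≡ false

      t≤D : t ≤ D
      t≤D = ≤-trans (m≤n*m t (2 * q)) 2qt≤deg

      misses-much : ∀ {Q} → count Q < t → ∀ {a} → Far B q x a ≡ true →
                    count (B x ∖ Q) ≤ 2 * q * count ((B x ∖ Q) ∖ B a)
      misses-much {Q} |Q|<t {a} far = ≤-trans (count-mono {P = B x ∖ Q} {B x} (proj₁ ∘ ∧-true⁻))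
        (absorb-≤ q (far⁻ B q far)
          (count-⊆-∪ {P = B x ∖ B a} {(B x ∖ Q) ∖ B a} {Q} λ {b} → cover (B x b) (Q b) (B a b))
          (≤-trans (*-monoʳ-≤ (2 * q) (<⇒≤ |Q|<t)) 2qt≤deg))
        where
        cover : ∀ p q r → p ∧ not r ≡ true → ((p ∧ not q) ∧ not r) ∨ q ≡ true
        cover true false false _ = refl
        cover true true  false _ = refl

      rest-nonempty : ∀ {Q} → count Q < t → 0 < count (B x ∖ Q)
      rest-nonempty {Q} |Q|<t = +-cancelʳ-< (count Q) 0 _ (<-≤-trans |Q|<t (≤-trans t≤D
        (count-⊆-∪ {P = B x} {B x ∖ Q} {Q} λ {b} → cover (B x b) (Q b))))
        where
        cover : ∀ p q → p ≡ true → (p ∧ not q) ∨ q ≡ true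
        cover true false _ = refl
        cover true true  _ = refl

      heavy-leaf : ∀ k (A Q : Fin n → Bool) → count Q < t → t * (2 * q) ^ suc k ≤ count A → A ⊆ FarNbr →
                   ∃ λ b → (B x ∖ Q) b ≡ true × t * (2 * q) ^ k ≤ count (A ∖ flip B b)
      heavy-leaf k A Q |Q|<t c'≤|A| A⊆ =
        let b , Rb , c≤|Missed·b| = averaging R (rest-nonempty |Q|<t) off-R cW≤Σ
        in b , Rb , ≤-trans c≤|Missed·b| (count-mono {P = λ a → Missed a b} {A ∖ flip B b}
                                            λ {a} → drop-R (A a) (R b) (B a b))
        where
        R : Fin n → Bool
        R = B x ∖ Q
        W c : ℕ
        W = count R
        c = t * (2 * q) ^ k
        Missed : Fin n → Fin n → Bool
        Missed a b = A a ∧ (R ∖ B a) b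

        drop-R : ∀ p r s → p ∧ (r ∧ not s) ≡ true → p ∧ not s ≡ true
        drop-R true true false _ = refl

        off-R : ∀ {b} → R b ≡ false → count (λ a → Missed a b) ≡ 0
        off-R {b} Rb = count-∅ λ a → trans (cong (λ r → A a ∧ (r ∧ not (B a b))) Rb) (∧-zeroʳ (A a))

        W≤2q|Missed| : ∀ {a} → A a ≡ true → W ≤ 2 * q * count (Missed a)
        W≤2q|Missed| {a} Aa = subst (λ m → W ≤ 2 * q * m) (count-cong λ b → cong (_∧ (R ∖ B a) b) (sym Aa))
          (misses-much |Q|<t (proj₂ (∧-true⁻ (A⊆ Aa))))

        cW≤Σ : count R * c ≤ sumF (λ b → count (λ a → Missed a b))
        cW≤Σ = *-cancelˡ-≤ (2 * q) (begin
          2 * q * (count R * c)                   ≡⟨ rearrange (2 * q) W t ((2 * q) ^ k) ⟩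
          t * (2 * q * (2 * q) ^ k) * W           ≤⟨ *-monoˡ-≤ W c'≤|A| ⟩
          count A * W                             ≤⟨ count*≤sumF A W≤2q|Missed| ⟩
          sumF (λ a → 2 * q * count (Missed a))   ≡⟨ sumF-*ˡ (2 * q) (count ∘ Missed) ⟩
          2 * q * sumF (count ∘ Missed)           ≡⟨ cong (2 * q *_) (count-swap Missed) ⟩
          2 * q * sumF (λ b → count (λ a → Missed a b)) ∎)
          where
          open ≤-Reasoning
          rearrange : ∀ a w t p → a * (w * (t * p)) ≡ t * (a * p) * w
          rearrange = solve-∀

      -- A greedy construction of an induced S_{t,t}: Q collects the leaves at x, while A shrinks
      -- to the far neighbours of y missing all of Q.
      grow : ∀ k (A Q : Fin n → Bool) → count Q + k ≡ t → t * (2 * q) ^ k ≤ count A →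
             A ⊆ FarNbr → Q ⊆ B x → Anticomplete A Q → ⊥
      grow zero A Q |Q|≡t t≤|A| A⊆ Q⊆ A-Q = free (inducedBiclaw B xy
        xs xs-inj (λ i → proj₁ (∧-true⁻ (A⊆ (A-xs i)))) xs≢x
        ys ys-inj (λ j → Q⊆ (Q-ys j)) ys≢y
        (λ i j → A-Q (A-xs i) (Q-ys j)))
        where
        enumA = count-enumerate A (subst (_≤ count A) (*-identityʳ t) t≤|A|)
        enumQ = count-enumerate Q (≤-reflexive (trans (sym |Q|≡t) (+-identityʳ (count Q))))
        xs = proj₁ enumA ; xs-inj = proj₁ (proj₂ enumA) ; A-xs = proj₂ (proj₂ enumA)
        ys = proj₁ enumQ ; ys-inj = proj₁ (proj₂ enumQ) ; Q-ys = proj₂ (proj₂ enumQ)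
        xs≢x : ∀ i → xs i ≢ x
        xs≢x i refl = contradiction (proj₂ (∧-true⁻ (A⊆ (A-xs i))))
                        (λ far → case trans (sym far) (not-far-from-self B {q} (count-pos (B x) xy)) of λ ())
        ys≢y : ∀ j → ys j ≢ y
        ys≢y j refl = contradiction (trans (sym (proj₁ (∧-true⁻ (A⊆ (A-xs j))))) (A-Q (A-xs j) (Q-ys j))) λ ()
      grow (suc k) A Q |Q|+1+k≡t c'≤|A| A⊆ Q⊆ A-Q with heavy-leaf k A Q |Q|<t c'≤|A| A⊆
        where
        |Q|<t : count Q < t
        |Q|<t = subst (count Q <_) |Q|+1+k≡t (≤-trans (s≤s (m≤m+n (count Q) k)) (≤-reflexive (sym (+-suc (count Q) k))))
      ... | b , Rb , c≤|A'| =
        grow k (A ∖ flip B b) (Q ∪ ⁅ b ⁆) |Q'|+k≡t c≤|A'| (A⊆ ∘ proj₁ ∘ ∧-true⁻) Q'⊆ A'-Q'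
        where
        |Q'|+k≡t : count (Q ∪ ⁅ b ⁆) + k ≡ t
        |Q'|+k≡t = trans (cong (_+ k) (count-insert Q (proj₂ (∖-true⁻ Rb)))) (trans (sym (+-suc (count Q) k)) |Q|+1+k≡t)
        Q'⊆ : Q ∪ ⁅ b ⁆ ⊆ B x
        Q'⊆ {j} Q'j with Q j in Qj
        ... | true  = Q⊆ Qj
        ... | false rewrite does-true⁻ (j ≟ b) Q'j = proj₁ (∧-true⁻ Rb)
        A'-Q' : Anticomplete (A ∖ flip B b) (Q ∪ ⁅ b ⁆)
        A'-Q' {a} {j} A'a Q'j with Q j in Qj
        ... | true  = A-Q (proj₁ (∧-true⁻ A'a)) Qj
        ... | false rewrite does-true⁻ (j ≟ b) Q'j = proj₂ (∖-true⁻ A'a)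

    few-far-neighbours : count (flip B y ∩ Far B q x) < t * (2 * q) ^ t
    few-far-neighbours = ≰⇒> λ K≤|FarNbr| →
      grow t FarNbr (λ _ → false) (cong (_+ t) (count-∅ {n} λ _ → refl)) K≤|FarNbr| id (λ ()) (λ _ ())

  -- Few vertices are far from a vertex of maximum degree

  large-remainder : ∀ {q m D K a} → 2 ≤ q → q * m < D → 2 * K ≤ D → D ≤ m + a → K < a
  large-remainder {q} {m} {D} {K} {a} 2≤q qm<D 2K≤D D≤m+a = ≰⇒> λ a≤K → <-irrefl refl (begin-strict
    D + D                 ≡⟨ cong (D +_) (+-identityʳ D) ⟨
    2 * D                 ≤⟨ *-monoʳ-≤ 2 D≤m+a ⟩
    2 * (m + a)           ≡⟨ *-distribˡ-+ 2 m a ⟩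
    2 * m + 2 * a         <⟨ +-mono-<-≤ (≤-<-trans (*-monoˡ-≤ m 2≤q) qm<D) (≤-trans (*-monoʳ-≤ 2 a≤K) 2K≤D) ⟩
    D + D                 ∎)
    where open ≤-Reasoning

  at-most-double : ∀ {q D c m} → 4 ≤ q → D ≡ c + m → q * m < 2 * D → D ≤ 2 * c
  at-most-double {q} {D} {c} {m} 4≤q D≡c+m qm<2D = +-cancelʳ-≤ D D (2 * c) (begin
    D + D                 ≡⟨ cong (D +_) (+-identityʳ D) ⟨
    2 * D                 ≡⟨ cong (2 *_) D≡c+m ⟩
    2 * (c + m)           ≡⟨ *-distribˡ-+ 2 c m ⟩
    2 * c + 2 * m         ≤⟨ +-monoʳ-≤ (2 * c) (*-cancelˡ-≤ 2 (<⇒≤ 4m<2D)) ⟩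
    2 * c + D             ∎)
    where
    open ≤-Reasoning
    4m<2D : 2 * (2 * m) < 2 * D
    4m<2D = subst (_< 2 * D) (*-assoc 2 2 m) (≤-<-trans (*-monoˡ-≤ m 4≤q) qm<2D)

  module _ {n : ℕ} (B : Fin n → Fin n → Bool) {t q d : ℕ} (4≤q : 4 ≤ q)
           (free : InducedBiclawFree (bipGraph B) t t) (conn : Connected (bipGraph B))
           (δ≥d : MinDegAtLeast B d) (0<d : 0 < d) (2qt≤d : 2 * q * t ≤ d) (12K≤d : 12 * (t * (2 * q) ^ t) ≤ d)
           {x₀ : Fin n} (x₀-max : ∀ u → count (B u) ≤ count (B x₀)) where

    private
      instance
        q≢0 : NonZero q
        q≢0 = >-nonZero (≤-trans (s≤s z≤n) 4≤q)

      K D : ℕ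
      K = t * (2 * q) ^ t
      D = count (B x₀)

      E : Fin n → Bool
      E = Far B q x₀

      D>0 : 0 < D
      D>0 = ≤-trans 0<d (δ≥d (inj₁ x₀))

      few-far-nbrs-of-edge : ∀ {x y} → B x y ≡ true → count (flip B y ∩ Far B q x) < K
      few-far-nbrs-of-edge {x} xy = few-far-neighbours B free xy (≤-trans 2qt≤d (δ≥d (inj₁ x)))

      Middling : Fin n → Bool
      Middling z = E z ∧ not (does (2 * D ≤? q * missing B x₀ z))

      -- Middling vertices share half of N(x₀), while each y ∈ N(x₀) has fewer than K neighbours far from x₀.
      few-middling : count Middling < 2 * K
      few-middling = ≰⇒> λ 2K≤|M| →
        let y , x₀y , K≤ = averaging (B x₀) D>0 off-N (DK≤Σ 2K≤|M|)
        in <⇒≱ (few-far-nbrs-of-edge x₀y)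
               (≤-trans K≤ (count-mono {P = λ z → Common z y} {flip B y ∩ E} λ {z} → pick (E z) _ (B x₀ y) (B z y)))
        where
        Common : Fin n → Fin n → Bool
        Common z y = Middling z ∧ (B x₀ y ∧ B z y)
        pick : ∀ e h a b → (e ∧ h) ∧ (a ∧ b) ≡ true → b ∧ e ≡ true
        pick true true true true _ = refl
        off-N : ∀ {y} → B x₀ y ≡ false → count (λ z → Common z y) ≡ 0
        off-N {y} x₀y = count-∅ λ z → trans (cong (λ b → Middling z ∧ (b ∧ B z y)) x₀y) (∧-zeroʳ (Middling z))
        D≤2|Common| : ∀ {z} → Middling z ≡ true → D ≤ 2 * count (Common z)
        D≤2|Common| {z} Mz = subst (λ c → D ≤ 2 * c) (count-cong λ y → cong (_∧ (B x₀ y ∧ B z y)) (sym Mz))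
          (at-most-double 4≤q (count-split (B x₀) (B z))
            (≰⇒> (does-false⁻ (2 * D ≤? q * missing B x₀ z) (not-true⁻ (proj₂ (∧-true⁻ Mz))))))
        DK≤Σ : 2 * K ≤ count Middling → D * K ≤ sumF (λ y → count (λ z → Common z y))
        DK≤Σ 2K≤|M| = *-cancelˡ-≤ 2 (begin
          2 * (D * K)                            ≡⟨ rearrange D K ⟩
          D * (2 * K)                            ≤⟨ *-monoʳ-≤ D 2K≤|M| ⟩
          D * count Middling                     ≡⟨ *-comm D _ ⟩
          count Middling * D                     ≤⟨ count*≤sumF Middling D≤2|Common| ⟩
          sumF (λ z → 2 * count (Common z))      ≡⟨ sumF-*ˡ 2 (count ∘ Common) ⟩
          2 * sumF (count ∘ Common)              ≡⟨ cong (2 *_) (count-swap Common) ⟩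
          2 * sumF (λ y → count (λ z → Common z y)) ∎)
          where
          open ≤-Reasoning
          rearrange : ∀ a b → 2 * (a * b) ≡ a * (2 * b)
          rearrange = solve-∀

      not-doubly-far : ∀ {v z} → E v ≡ false → Far B q v z ≡ false →
        q * missing B x₀ z < 2 * D
      not-doubly-far {v} {z} Ev Fvz = begin-strict
        q * missing B x₀ z                              ≤⟨ *-monoʳ-≤ q (missing-triangle B x₀ v z) ⟩
        q * (missing B x₀ v + missing B v z)            ≡⟨ *-distribˡ-+ q _ _ ⟩
        q * missing B x₀ v + q * missing B v z
          <⟨ +-mono-< (near⁻ B q Ev) (<-≤-trans (near⁻ B q Fvz) (x₀-max v)) ⟩
        D + D                                           ≡⟨ cong (D +_) (+-identityʳ D) ⟨
        2 * D                                           ∎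
        where open ≤-Reasoning

      few-far-nbrs-if-near-nbr : ∀ {v w} → E v ≡ false → B v w ≡ true → count (flip B w ∩ E) < 3 * K
      few-far-nbrs-if-near-nbr {v} {w} Ev vw = ≤-<-trans
        (count-⊆-∪ {P = flip B w ∩ E} {flip B w ∩ Far B q v} {Middling} cover)
        (+-mono-< (few-far-nbrs-of-edge vw) few-middling)
        where
        cover : flip B w ∩ E ⊆ (flip B w ∩ Far B q v) ∪ Middling
        cover {z} zw∧Ez = either (B z w) (E z) (Far B q v z) _ zw∧Ez λ Fvz →
          dec-false (2 * D ≤? q * missing B x₀ z) (<⇒≱ (not-doubly-far Ev Fvz))
          where
          either : ∀ a e f h → a ∧ e ≡ true → (f ≡ false → h ≡ false) → (a ∧ f) ∨ (e ∧ not h) ≡ true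
          either true true true  h _ _   = refl
          either true true false h _ f⇒h rewrite f⇒h refl = refl

      near-nbr? : ∀ w → Dec (∃ λ z → E z ≡ false × B z w ≡ true)
      near-nbr? w = any? λ z → (E z ≟ᵇ false) ×-dec (B z w ≟ᵇ true)

      Anchored : Fin n → Bool
      Anchored w = does (near-nbr? w)

      anchored⁺ : ∀ {z w} → E z ≡ false → B z w ≡ true → Anchored w ≡ true
      anchored⁺ {z} {w} Ez zw = dec-true (near-nbr? w) (z , Ez , zw)

      few-far-nbrs-if-anchored : ∀ {w} → Anchored w ≡ true → count (flip B w ∩ E) < 3 * K
      few-far-nbrs-if-anchored {w} Aw =
        let z , Ez , zw = does-true⁻ (near-nbr? w) Aw in few-far-nbrs-if-near-nbr Ez zw

      cK≤d : ∀ c → c ≤ 12 → c * K ≤ d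
      cK≤d c c≤12 = ≤-trans (*-monoˡ-≤ K c≤12) 12K≤d

      2≤q : 2 ≤ q
      2≤q = ≤-trans (m≤m+n 2 2) 4≤q

      near-to-both : ∀ {u w'} → B u w' ≡ true → Anchored w' ≡ true → ∃ λ z → E z ≡ false × Far B q u z ≡ false
      near-to-both {u} {w'} uw' Aw' =
        let z , w'∖E-z , ¬far = count-<⇒∃∖ (flip B w' ∖ E) (flip B w' ∩ Far B q u)
                                   (<-trans (few-far-nbrs-of-edge uw') K<|w'∖E|)
            zw' , Ez = ∖-true⁻ w'∖E-z
        in z , Ez , ∧-false⁻ʳ zw' ¬far
        where
        open ≤-Reasoning
        K<|w'∖E| : K < count (flip B w' ∖ E)
        K<|w'∖E| = +-cancelˡ-< (3 * K) K _ (begin-strict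
          3 * K + K                                      ≡⟨ +-comm (3 * K) K ⟩
          4 * K                                          ≤⟨ cK≤d 4 (m≤m+n 4 8) ⟩
          d                                              ≤⟨ δ≥d (inj₂ w') ⟩
          count (flip B w')                              ≡⟨ count-split (flip B w') E ⟩
          count (flip B w' ∩ E) + count (flip B w' ∖ E)  <⟨ +-monoˡ-< _ (few-far-nbrs-if-anchored Aw') ⟩
          3 * K + count (flip B w' ∖ E)                  ∎)

      many-anchored-nbrs : ∀ {u z} → E z ≡ false → Far B q u z ≡ false → K < count (B u ∩ Anchored)
      many-anchored-nbrs {u} {z} Ez Fuz = large-remainder 2≤q
        (≤-<-trans (*-monoʳ-≤ q (count-mono {P = B u ∖ Anchored} {B u ∖ B z} unanchored⊆missed)) (near⁻ B q Fuz))
        (≤-trans (cK≤d 2 (m≤m+n 2 10)) (δ≥d (inj₁ u)))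
        (≤-reflexive (trans (count-split (B u) Anchored) (+-comm (count (B u ∩ Anchored)) _)))
        where
        unanchored⊆missed : B u ∖ Anchored ⊆ B u ∖ B z
        unanchored⊆missed {b} = keep (B u b) (Anchored b) (B z b) (anchored⁺ Ez)
          where
          keep : ∀ a h c → (c ≡ true → h ≡ true) → a ∧ not h ≡ true → a ∧ not c ≡ true
          keep true false false _   _ = refl
          keep true false true  c⇒h _ = case c⇒h refl of λ ()

      -- Some anchored neighbour y' of u is near w in the transposed graph, so N(w) lies mostly inside N(y'),
      -- which contains fewer than 3K vertices far from x₀.
      anchored-if-many-anchored-nbrs : ∀ {u w} → B u w ≡ true → K < count (B u ∩ Anchored) → Anchored w ≡ true
      anchored-if-many-anchored-nbrs {u} {w} uw K<|u∩A| =
        let _ , w∖E-z = count-pos⇒∃ (flip B w ∖ E) w∖E≢∅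
        in anchored⁺ (proj₂ (∖-true⁻ w∖E-z)) (proj₁ (∖-true⁻ w∖E-z))
        where
        y'-data = count-<⇒∃∖ (B u ∩ Anchored) (B u ∩ Far (flip B) q w)
                    (<-trans (few-far-neighbours (flip B) (flip-biclawFree B free) uw (≤-trans 2qt≤d (δ≥d (inj₂ w))))
                             K<|u∩A|)
        y' = proj₁ y'-data
        Ay' : Anchored y' ≡ true
        Ay' = proj₂ (∧-true⁻ (proj₁ (proj₂ y'-data)))
        F'wy' : Far (flip B) q w y' ≡ false
        F'wy' = ∧-false⁻ʳ (proj₁ (∧-true⁻ (proj₁ (proj₂ y'-data)))) (proj₂ (proj₂ y'-data))

        far-nbrs-of-w : count (flip B w ∩ E) ≤ missing (flip B) w y' + count (flip B y' ∩ E)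
        far-nbrs-of-w = count-⊆-∪ {P = flip B w ∩ E} {flip B w ∖ flip B y'} {flip B y' ∩ E}
          λ {z} → split (B z w) (B z y') (E z)
          where
          split : ∀ a b e → a ∧ e ≡ true → (a ∧ not b) ∨ (b ∧ e) ≡ true
          split true false true _ = refl
          split true true  true _ = refl

        w∖E≢∅ : 0 < count (flip B w ∖ E)
        w∖E≢∅ = +-cancelˡ-< (count (flip B y' ∩ E)) 0 _ (<-trans
          (≤-<-trans (≤-reflexive (+-identityʳ _)) (few-far-nbrs-if-anchored Ay'))
          (large-remainder 2≤q (near⁻ (flip B) q F'wy')
            (subst (_≤ count (flip B w)) (*-assoc 2 3 K) (≤-trans (cK≤d 6 (m≤m+n 6 6)) (δ≥d (inj₂ w))))
            (begin
              count (flip B w)                                                     ≡⟨ count-split (flip B w) E ⟩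
              count (flip B w ∩ E) + count (flip B w ∖ E)                          ≤⟨ +-monoˡ-≤ _ far-nbrs-of-w ⟩
              missing (flip B) w y' + count (flip B y' ∩ E) + count (flip B w ∖ E) ≡⟨ +-assoc (missing (flip B) w y') _ _ ⟩
              missing (flip B) w y' + (count (flip B y' ∩ E) + count (flip B w ∖ E)) ∎)))
          where open ≤-Reasoning

      anchored-spreads : ∀ {u w' w} → B u w' ≡ true → Anchored w' ≡ true → B u w ≡ true → Anchored w ≡ true
      anchored-spreads uw' Aw' uw =
        let _ , Ez , Fuz = near-to-both uw' Aw' in anchored-if-many-anchored-nbrs uw (many-anchored-nbrs Ez Fuz)

      Reached : Fin n ⊎ Fin n → Set
      Reached (inj₁ u) = ∃ λ w → B u w ≡ true × Anchored w ≡ true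
      Reached (inj₂ w) = Anchored w ≡ true

      reached-step : ∀ {p p'} → BAdj B p p' → Reached p → Reached p'
      reached-step {inj₁ u} {inj₂ w} uw (w' , uw' , Aw') = anchored-spreads uw' Aw' uw
      reached-step {inj₂ w} {inj₁ u} uw Aw                = w , uw , Aw

      x₀-reached : Reached (inj₁ x₀)
      x₀-reached = let y , x₀y = count-pos⇒∃ (B x₀) D>0
                   in y , x₀y , anchored⁺ (not-far-from-self B {q} D>0) x₀y

    few-far-from-max-nbrs : ∀ w → count (flip B w ∩ Far B q x₀) < 3 * K
    few-far-from-max-nbrs w = few-far-nbrs-if-anchored
      (fold (λ p p' → Reached p → Reached p') (λ e → _∘ reached-step e) id (conn (inj₁ x₀) (inj₂ w)) x₀-reached)

    few-far-from-max : count (Far B q x₀) * d ≤ n * (3 * K)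
    few-far-from-max = begin
      count E * d
        ≤⟨ count*≤sumF E (λ {u} Eu → subst (λ e → d ≤ count (λ w → e ∧ B u w)) (sym Eu) (δ≥d (inj₁ u))) ⟩
      sumF (λ u → count (λ w → E u ∧ B u w))      ≡⟨ count-swap (λ u w → E u ∧ B u w) ⟩
      sumF (λ w → count (λ u → E u ∧ B u w))
        ≤⟨ sumF-mono (λ w → ≤-trans (≤-reflexive (count-cong λ u → ∧-comm (E u) (B u w)))
                                     (<⇒≤ (few-far-from-max-nbrs w))) ⟩
      sumF {n} (λ _ → 3 * K)                      ≡⟨ sumF-const n (3 * K) ⟩
      n * (3 * K)                                 ∎
      where open ≤-Reasoning

  -- Counting non-edges

  nonEdges : ∀ {n} → (Fin n → Fin n → Bool) → ℕ
  nonEdges B = edges (λ i j → not (B i j))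

  edges+nonEdges : ∀ {n} (B : Fin n → Fin n → Bool) → edges B + nonEdges B ≡ n * n
  edges+nonEdges {n} B = begin
    edges B + nonEdges B                                  ≡⟨ sumF-+ (count ∘ B) (λ i → count (λ j → not (B i j))) ⟨
    sumF (λ i → count (B i) + count (λ j → not (B i j)))
      ≡⟨ sumF-cong (λ i → trans (sym (count-split (λ _ → true) (B i))) (count-full n)) ⟩
    sumF {n} (λ _ → n)                                    ≡⟨ sumF-const n n ⟩
    n * n                                                 ∎
    where open ≡-Reasoning

  nonEdges-flip : ∀ {n} (B : Fin n → Fin n → Bool) → nonEdges (flip B) ≡ nonEdges B
  nonEdges-flip B = sym (count-swap λ i j → not (B i j))

  fraction-bound : ∀ q k n {c d} → c * d ≤ n * k → q * (k + 1) ≤ d → q * c ≤ n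
  fraction-bound q k n {c} {d} cd≤nk q[k+1]≤d = *-cancelʳ-≤ (q * c) n (k + 1) {{k+1≢0}} (begin
    q * c * (k + 1)     ≡⟨ rearrange q c (k + 1) ⟩
    c * (q * (k + 1))   ≤⟨ *-monoʳ-≤ c q[k+1]≤d ⟩
    c * d               ≤⟨ cd≤nk ⟩
    n * k               ≤⟨ *-monoʳ-≤ n (m≤m+n k 1) ⟩
    n * (k + 1)         ∎)
    where
    open ≤-Reasoning
    rearrange : ∀ a b c → a * b * c ≡ b * (a * c)
    rearrange = solve-∀
    k+1≢0 : NonZero (k + 1)
    k+1≢0 = >-nonZero (m≤n+m 1 k)

  at-most-double-with-error : ∀ {q D m a e} → 4 ≤ q → q * m < D → 4 * e ≤ D → D ≤ m + (a + e) → D ≤ 2 * a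
  at-most-double-with-error {q} {D} {m} {a} {e} 4≤q qm<D 4e≤D D≤m+a+e =
    <⇒≤ (*-cancelˡ-< 2 D (2 * a) (+-cancelʳ-< (2 * D) _ _ (begin-strict
    2 * D + 2 * D               ≡⟨ *-distribʳ-+ D 2 2 ⟨
    4 * D                       ≤⟨ *-monoʳ-≤ 4 D≤m+a+e ⟩
    4 * (m + (a + e))           ≡⟨ rearrange m a e ⟩
    4 * m + 4 * e + 4 * a       <⟨ +-monoˡ-< (4 * a) (+-mono-<-≤ (≤-<-trans (*-monoˡ-≤ m 4≤q) qm<D) 4e≤D) ⟩
    D + D + 4 * a               ≡⟨ rearrange′ D a ⟩
    2 * (2 * a) + 2 * D         ∎)))
    where
    open ≤-Reasoning
    rearrange : ∀ m a e → 4 * (m + (a + e)) ≡ 4 * m + 4 * e + 4 * a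
    rearrange = solve-∀
    rearrange′ : ∀ D a → D + D + 4 * a ≡ 2 * (2 * a) + 2 * D
    rearrange′ = solve-∀

  five-n² : ∀ q n {cE cY X} → q * cE ≤ n → q * cY ≤ 3 * n → X ≤ cE * (q * n) + n * (q * cY + n) →
    X ≤ 5 * (n * n)
  five-n² q n {cE} {cY} qcE≤n qcY≤3n X≤ = ≤-trans X≤ (begin
    cE * (q * n) + n * (q * cY + n)   ≡⟨ cong (_+ n * (q * cY + n)) (rearrange cE q n) ⟩
    q * cE * n + n * (q * cY + n)     ≤⟨ +-mono-≤ (*-monoˡ-≤ n qcE≤n) (*-monoʳ-≤ n (+-monoˡ-≤ n qcY≤3n)) ⟩
    n * n + n * (3 * n + n)           ≡⟨ collect n ⟩
    5 * (n * n)                       ∎)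
    where
    open ≤-Reasoning
    rearrange : ∀ a b c → a * (b * c) ≡ b * a * c
    rearrange = solve-∀
    collect : ∀ n → n * n + n * (3 * n + n) ≡ 5 * (n * n)
    collect = solve-∀

  module _ {n : ℕ} (B : Fin n → Fin n → Bool) {q K d : ℕ} (4≤q : 4 ≤ q)
           (δ≥d : MinDegAtLeast B d) (q[3K+1]≤d : q * (3 * K + 1) ≤ d) (12K≤d : 12 * K ≤ d)
           {x₀ y₀ : Fin n} (x₀-max : ∀ u → count (B u) ≤ count (B x₀))
           (D≤D' : count (B x₀) ≤ count (flip B y₀))
           (few-far-nbrs-y₀ : count (flip B y₀ ∩ Far B q x₀) < 3 * K)
           (few-far : count (Far B q x₀) * d ≤ n * (3 * K))
           (few-far' : count (Far (flip B) q y₀) * d ≤ n * (3 * K)) where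

    private
      D D' : ℕ
      D  = count (B x₀)
      D' = count (flip B y₀)

      E E' NonAdj₀ G : Fin n → Bool
      E  = Far B q x₀
      E' = Far (flip B) q y₀
      NonAdj₀ w = not (B x₀ w)
      G = NonAdj₀ ∖ E'

      instance
        q≢0 : NonZero q
        q≢0 = >-nonZero (≤-trans (s≤s z≤n) 4≤q)
        D'≢0 : NonZero D'
        D'≢0 = >-nonZero (≤-trans (≤-trans (m≤n+m 1 (3 * K)) (m≤n*m (3 * K + 1) q))
                                  (≤-trans q[3K+1]≤d (δ≥d (inj₂ y₀))))

      D'≤2|nearNbrs| : ∀ {w} → G w ≡ true → D' ≤ 2 * count (λ z → not (E z) ∧ B z w)
      D'≤2|nearNbrs| {w} Gw =
        at-most-double-with-error {a = count (λ z → not (E z) ∧ B z w)} {count (flip B y₀ ∩ E)} 4≤q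
          (near⁻ (flip B) q (not-true⁻ (proj₂ (∧-true⁻ Gw))))
          (≤-trans (*-monoʳ-≤ 4 (<⇒≤ few-far-nbrs-y₀))
                    (subst (_≤ D') (*-assoc 4 3 K) (≤-trans 12K≤d (δ≥d (inj₂ y₀)))))
          (begin
            D'                                                     ≡⟨ count-split (flip B y₀) (flip B w) ⟩
            count (flip B y₀ ∩ flip B w) + missing (flip B) y₀ w   ≤⟨ +-monoˡ-≤ _ common≤ ⟩
            count (λ z → not (E z) ∧ B z w) + count (flip B y₀ ∩ E) + missing (flip B) y₀ w
              ≡⟨ +-comm _ (missing (flip B) y₀ w) ⟩
            missing (flip B) y₀ w + (count (λ z → not (E z) ∧ B z w) + count (flip B y₀ ∩ E)) ∎)
        where
        open ≤-Reasoning
        common≤ : count (flip B y₀ ∩ flip B w) ≤ count (λ z → not (E z) ∧ B z w) + count (flip B y₀ ∩ E)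
        common≤ = count-⊆-∪ {P = flip B y₀ ∩ flip B w} λ {z} → split (B z y₀) (B z w) (E z)
          where
          split : ∀ a b e → a ∧ b ≡ true → (not e ∧ b) ∨ (a ∧ e) ≡ true
          split true true false _ = refl
          split true true true  _ = refl

      Link : Fin n → Fin n → Bool
      Link w z = G w ∧ (not (E z) ∧ B z w)

      D'≤2|Link| : ∀ {w} → G w ≡ true → D' ≤ 2 * count (Link w)
      D'≤2|Link| {w} Gw = subst (λ c → D' ≤ 2 * c) (count-cong λ z → cong (_∧ (not (E z) ∧ B z w)) (sym Gw))
                            (D'≤2|nearNbrs| Gw)

      q|Link·z|≤D' : ∀ z → q * count (λ w → Link w z) ≤ D'
      q|Link·z|≤D' z with E z in Ez
      ... | true  = subst (_≤ D') (sym (trans (cong (q *_) (count-∅ λ w → ∧-zeroʳ (G w))) (*-zeroʳ q))) z≤n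
      ... | false = ≤-trans (*-monoʳ-≤ q (≤-trans
                      (count-mono {P = λ w → G w ∧ (true ∧ B z w)} {B z ∖ B x₀}
                                  λ {w} → pick (B x₀ w) (E' w) (B z w))
                      (missing-≤-of-deg-≤ B (x₀-max z))))
                    (<⇒≤ (<-≤-trans (near⁻ B q Ez) D≤D'))
        where
        pick : ∀ a e b → (not a ∧ not e) ∧ (true ∧ b) ≡ true → b ∧ not a ≡ true
        pick false false true _ = refl

      q|G|≤2n : q * count G ≤ 2 * n
      q|G|≤2n = *-cancelʳ-≤ (q * count G) (2 * n) D' (begin
        q * count G * D'                                  ≡⟨ *-assoc q (count G) D' ⟩
        q * (count G * D')                                ≤⟨ *-monoʳ-≤ q (count*≤sumF G D'≤2|Link|) ⟩
        q * sumF (λ w → 2 * count (Link w))               ≡⟨ cong (q *_) (sumF-*ˡ 2 (count ∘ Link)) ⟩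
        q * (2 * sumF (count ∘ Link))                     ≡⟨ cong (λ s → q * (2 * s)) (count-swap Link) ⟩
        q * (2 * sumF (λ z → count (λ w → Link w z)))     ≡⟨ rearrange q (sumF (λ z → count (λ w → Link w z))) ⟩
        2 * (q * sumF (λ z → count (λ w → Link w z)))     ≡⟨ cong (2 *_) (sumF-*ˡ q (count ∘ flip Link)) ⟨
        2 * sumF (λ z → q * count (λ w → Link w z))       ≤⟨ *-monoʳ-≤ 2 (sumF-mono q|Link·z|≤D') ⟩
        2 * sumF {n} (λ _ → D')                           ≡⟨ cong (2 *_) (sumF-const n D') ⟩
        2 * (n * D')                                      ≡⟨ *-assoc 2 n D' ⟨
        2 * n * D'                                        ∎)
        where
        open ≤-Reasoning
        rearrange : ∀ a b → a * (2 * b) ≡ 2 * (a * b)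
        rearrange = solve-∀

      q|NonAdj₀|≤3n : q * count NonAdj₀ ≤ 3 * n
      q|NonAdj₀|≤3n = begin
        q * count NonAdj₀
          ≤⟨ *-monoʳ-≤ q (count-⊆-∪ {P = NonAdj₀} {E'} {G} λ {w} → cover (NonAdj₀ w) (E' w)) ⟩
        q * (count E' + count G)        ≡⟨ *-distribˡ-+ q (count E') (count G) ⟩
        q * count E' + q * count G      ≤⟨ +-mono-≤ (fraction-bound q (3 * K) n few-far' q[3K+1]≤d) q|G|≤2n ⟩
        n + 2 * n                       ∎
        where
        open ≤-Reasoning
        cover : ∀ h e → h ≡ true → e ∨ (h ∧ not e) ≡ true
        cover true false _ = refl
        cover true true  _ = refl

    q*nonEdges≤5n² : q * nonEdges B ≤ 5 * (n * n)
    q*nonEdges≤5n² = five-n² q n {count E} (fraction-bound q (3 * K) n few-far q[3K+1]≤d) q|NonAdj₀|≤3n (begin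
      q * nonEdges B                                         ≡⟨ sumF-*ˡ q (λ u → count (λ w → not (B u w))) ⟨
      sumF (λ u → q * count (λ w → not (B u w)))             ≤⟨ sumF≤count*+ E on-E off-E ⟩
      count E * (q * n) + n * (q * count NonAdj₀ + n)        ∎)
      where
      open ≤-Reasoning
      on-E : ∀ {u} → E u ≡ true → q * count (λ w → not (B u w)) ≤ q * n + (q * count NonAdj₀ + n)
      on-E _ = ≤-trans (*-monoʳ-≤ q (count≤size _)) (m≤m+n (q * n) _)
      off-E : ∀ {u} → E u ≡ false → q * count (λ w → not (B u w)) ≤ q * count NonAdj₀ + n
      off-E {u} Eu = begin
        q * count (λ w → not (B u w))
          ≤⟨ *-monoʳ-≤ q (count-⊆-∪ {P = λ w → not (B u w)} {NonAdj₀} {B x₀ ∖ B u}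
                                      λ {w} → cover (B x₀ w) (B u w)) ⟩
        q * (count NonAdj₀ + missing B x₀ u)             ≡⟨ *-distribˡ-+ q _ _ ⟩
        q * count NonAdj₀ + q * missing B x₀ u
          ≤⟨ +-monoʳ-≤ _ (<⇒≤ (<-≤-trans (near⁻ B q Eu) (count≤size (B x₀)))) ⟩
        q * count NonAdj₀ + n                            ∎
        where
        cover : ∀ a b → not b ≡ true → not a ∨ (a ∧ not b) ≡ true
        cover false false _ = refl
        cover true  false _ = refl

  argmax : ∀ {m} (f : Fin (suc m) → ℕ) → ∃ λ i → ∀ j → f j ≤ f i
  argmax {zero}  f = zero , λ { zero → ≤-refl }
  argmax {suc m} f with argmax (f ∘ suc)
  ... | i , max with ≤-total (f zero) (f (suc i))
  ...   | inj₁ f0≤fi = suc i , λ { zero → f0≤fi ; (suc j) → max j }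
  ...   | inj₂ fi≤f0 = zero  , λ { zero → ≤-refl ; (suc j) → ≤-trans (max j) fi≤f0 }

  degreeThreshold : ℕ → ℕ → ℕ
  degreeThreshold t q = 2 * q * t + 12 * K + q * (3 * K + 1)
    where K = t * (2 * q) ^ t

  module _ (t q : ℕ) (4≤q : 4 ≤ q) {n : ℕ} (B : Fin n → Fin n → Bool)
           (conn : Connected (bipGraph B)) (free : InducedBiclawFree (bipGraph B) t t)
           (δ≥d : MinDegAtLeast B (degreeThreshold t q)) where

    private
      K d : ℕ
      K = t * (2 * q) ^ t
      d = degreeThreshold t q

      2qt≤d : 2 * q * t ≤ d
      2qt≤d = ≤-trans (m≤m+n (2 * q * t) (12 * K)) (m≤m+n _ (q * (3 * K + 1)))
      12K≤d : 12 * K ≤ d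
      12K≤d = ≤-trans (m≤n+m (12 * K) (2 * q * t)) (m≤m+n _ (q * (3 * K + 1)))
      q[3K+1]≤d : q * (3 * K + 1) ≤ d
      q[3K+1]≤d = m≤n+m _ _
      0<d : 0 < d
      0<d = ≤-trans (≤-trans (≤-trans (s≤s z≤n) 4≤q) (m≤m*n q (3 * K + 1) {{>-nonZero (m≤n+m 1 (3 * K))}}))
                    q[3K+1]≤d

    nonEdges-bound-oriented : ∀ {x₀ y₀} → (∀ u → count (B u) ≤ count (B x₀)) →
      (∀ w → count (flip B w) ≤ count (flip B y₀)) → count (B x₀) ≤ count (flip B y₀) →
      q * nonEdges B ≤ 5 * (n * n)
    nonEdges-bound-oriented x₀-max y₀-max D≤D' = q*nonEdges≤5n² B {K = K} 4≤q δ≥d q[3K+1]≤d 12K≤d x₀-max D≤D'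
      (few-far-from-max-nbrs B 4≤q free conn δ≥d 0<d 2qt≤d 12K≤d x₀-max _)
      (few-far-from-max B 4≤q free conn δ≥d 0<d 2qt≤d 12K≤d x₀-max)
      (few-far-from-max (flip B) 4≤q (flip-biclawFree B free) (flip-connected B conn) (flip-minDeg B δ≥d)
                        0<d 2qt≤d 12K≤d y₀-max)

  nonEdges-bound : ∀ t q → 4 ≤ q → ∀ {n} (B : Fin n → Fin n → Bool) →
    Connected (bipGraph B) → InducedBiclawFree (bipGraph B) t t → MinDegAtLeast B (degreeThreshold t q) →
    q * nonEdges B ≤ 5 * (n * n)
  nonEdges-bound t q 4≤q {zero}  B _ _ _ = ≤-reflexive (*-zeroʳ q)
  nonEdges-bound t q 4≤q {suc n} B conn free δ≥d with argmax (count ∘ B) | argmax (count ∘ flip B)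
  ... | x₀ , x₀-max | y₀ , y₀-max with ≤-total (count (B x₀)) (count (flip B y₀))
  ...   | inj₁ D≤D' = nonEdges-bound-oriented t q 4≤q B conn free δ≥d x₀-max y₀-max D≤D'
  ...   | inj₂ D'≤D = subst (λ e → q * e ≤ 5 * (suc n * suc n)) (nonEdges-flip B)
                        (nonEdges-bound-oriented t q 4≤q (flip B) (flip-connected B conn) (flip-biclawFree B free)
                          (flip-minDeg B δ≥d) y₀-max x₀-max D'≤D)

  density-bound : ∀ t M .{{_ : NonZero M}} {n} (B : Fin n → Fin n → Bool) →
    Connected (bipGraph B) → InducedBiclawFree (bipGraph B) t t → MinDegAtLeast B (degreeThreshold t (5 * M)) →
    M * nonEdges B ≤ n * n
  density-bound t M {n} B conn free δ≥d = *-cancelˡ-≤ 5 (subst (_≤ 5 * (n * n)) (*-assoc 5 M (nonEdges B))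
    (nonEdges-bound t (5 * M) (≤-trans (m≤m+n 4 1) (m≤m*n 5 M)) B conn free δ≥d))

module RationalComplement where

  open import Defs
  open import Data.Nat as ℕ using (ℕ; suc)
  import Data.Nat.Properties as ℕ
  open import Data.Integer as ℤ using (ℤ; +_; +[1+_]; -[1+_]; +≤+)
  import Data.Integer.Properties as ℤ
  open import Data.Integer.Tactic.RingSolver using (solve-∀)
  open import Data.Rational as ℚ using (ℚ; mkℚ; 0ℚ; 1ℚ; _-_; ↧ₙ_; toℚᵘ)
  open import Data.Rational.Properties
    using (toℚᵘ-cancel-≤; toℚᵘ-homo-*; toℚᵘ-homo-+; toℚᵘ-homo‿-; toℚᵘ-fromℚᵘ)
  open import Data.Rational.Unnormalised as ℚᵘ using (mkℚᵘ; *≤*)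
  import Data.Rational.Unnormalised.Properties as ℚᵘ
  open import Relation.Binary.PropositionalEquality
  open import Relation.Nullary using (contradiction)

  private
    -- ℚᵘ's ≤ between (1 - (p+1)/(dm+1)) · (e+k) and e/1 unfolds to this inequality.
    complement-ℤ : ∀ p dm e k → suc dm ℕ.* k ℕ.≤ e ℕ.+ k →
      ((+ 1 ℤ.* + suc dm ℤ.+ -[1+ p ] ℤ.* + 1) ℤ.* + (e ℕ.+ k)) ℤ.* + 1 ℤ.≤ + e ℤ.* + (1 ℕ.* suc dm ℕ.* 1)
    complement-ℤ p dm e k Qk≤N = ℤ.i-j≤0⇒i≤j (begin
      ((+ 1 ℤ.* + suc dm ℤ.+ -[1+ p ] ℤ.* + 1) ℤ.* + (e ℕ.+ k)) ℤ.* + 1 ℤ.- + e ℤ.* + (1 ℕ.* suc dm ℕ.* 1)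
        ≡⟨ cong₂ (λ n q → ((+ 1 ℤ.* + suc dm ℤ.+ -[1+ p ] ℤ.* + 1) ℤ.* n) ℤ.* + 1 ℤ.- + e ℤ.* + q)
                 (ℤ.pos-+ e k) (trans (ℕ.*-identityʳ _) (ℕ.*-identityˡ _)) ⟩
      ((+ 1 ℤ.* + suc dm ℤ.+ -[1+ p ] ℤ.* + 1) ℤ.* N) ℤ.* + 1 ℤ.- + e ℤ.* + suc dm
        ≡⟨ balance (+ suc dm) +[1+ p ] (+ e) (+ k) ⟩
      + suc dm ℤ.* + k ℤ.- +[1+ p ] ℤ.* N
        ≤⟨ ℤ.i≤j⇒i-j≤0 Qk≤[1+p]N ⟩
      + 0 ∎)
      where
      open ℤ.≤-Reasoning
      N = + e ℤ.+ + k
      balance : ∀ Q P e k →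
        ((+ 1 ℤ.* Q ℤ.+ (ℤ.- P) ℤ.* + 1) ℤ.* (e ℤ.+ k)) ℤ.* + 1 ℤ.- e ℤ.* Q ≡ Q ℤ.* k ℤ.- P ℤ.* (e ℤ.+ k)
      balance = solve-∀
      Qk≤[1+p]N : + suc dm ℤ.* + k ℤ.≤ +[1+ p ] ℤ.* N
      Qk≤[1+p]N = subst₂ ℤ._≤_ (ℤ.pos-* (suc dm) k)
        (trans (ℤ.pos-* (suc p) (e ℕ.+ k)) (cong (+[1+ p ] ℤ.*_) (ℤ.pos-+ e k)))
        (+≤+ (ℕ.≤-trans Qk≤N (ℕ.m≤m+n (e ℕ.+ k) (p ℕ.* (e ℕ.+ k)))))

  complement-≤ : (ε : ℚ) → 0ℚ ℚ.< ε → ∀ {N e k} → e ℕ.+ k ≡ N → ↧ₙ ε ℕ.* k ℕ.≤ N →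
    (1ℚ - ε) ℚ.* ℕtoℚ N ℚ.≤ ℕtoℚ e
  complement-≤ ε@(mkℚ +[1+ p ] dm _) _ {e = e} {k} refl Qk≤N = toℚᵘ-cancel-≤
    (ℚᵘ.≤-respˡ-≃ (ℚᵘ.≃-sym lhs)
      (ℚᵘ.≤-respʳ-≃ (ℚᵘ.≃-sym (toℚᵘ-fromℚᵘ (mkℚᵘ (+ e) 0))) (*≤* (complement-ℤ p dm e k Qk≤N))))
    where
    lhs : toℚᵘ ((1ℚ - ε) ℚ.* ℕtoℚ (e ℕ.+ k)) ℚᵘ.≃
          (mkℚᵘ (+ 1) 0 ℚᵘ.- mkℚᵘ +[1+ p ] dm) ℚᵘ.* mkℚᵘ (+ (e ℕ.+ k)) 0
    lhs = ℚᵘ.≃-trans (toℚᵘ-homo-* (1ℚ - ε) (ℕtoℚ (e ℕ.+ k)))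
      (ℚᵘ.*-cong (ℚᵘ.≃-trans (toℚᵘ-homo-+ 1ℚ (ℚ.- ε))
                             (ℚᵘ.+-cong (toℚᵘ-fromℚᵘ (mkℚᵘ (+ 1) 0)) (toℚᵘ-homo‿- ε)))
                 (toℚᵘ-fromℚᵘ (mkℚᵘ (+ (e ℕ.+ k)) 0)))
  complement-≤ (mkℚ (+ 0) _ _) (ℚ.*<* 0<0) _ _ = contradiction 0<0 (ℤ.<-irrefl refl)
  complement-≤ (mkℚ -[1+ _ ] _ _) (ℚ.*<* ()) _ _

open import Defs
open import Data.Nat using (ℕ; _*_)
open import Data.Bool using (Bool)
open import Data.Fin using (Fin)
open import Data.Product using (Σ; _,_)
open import Data.Rational using (ℚ; 0ℚ; 1ℚ; _-_; _<_; _≤_)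
import Data.Rational as ℚ
open BiclawFreeDensity using (degreeThreshold; density-bound; edges+nonEdges)
open RationalComplement using (complement-≤)

theorem1p4 : (t : ℕ) → (ε : ℚ) → 0ℚ < ε →
    Σ ℕ (λ d → (n : ℕ) → (B : Fin n → Fin n → Bool) →
    Connected (bipGraph B) →
    InducedBiclawFree (bipGraph B) t t →
    MinDegAtLeast B d →
    (1ℚ - ε) ℚ.* ℕtoℚ (n * n) ≤ ℕtoℚ (edges B))
theorem1p4 t ε 0<ε = degreeThreshold t (5 * ℚ.↧ₙ ε) , λ n B conn free δ≥d →
  complement-≤ ε 0<ε (edges+nonEdges B) (density-bound t (ℚ.↧ₙ ε) B conn free δ≥d)
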